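{- Let $\mathcal{C}$ be a non-recursive catalogue (of SSL, ShEx, or SHACL shapes). Then the LFP, GFP, brave SMS and cautious SMS semantics coincide for $\mathcal{C}$: for every RDF graph $\mathcal{G}$ and every selector map $\mathit{sel}$ for $\mathcal{C}$, $\mathcal{G}$ LFP-conforms to $(\mathcal{C},\mathit{sel})$ iff it GFP-conforms iff it bravely SMS-conforms iff it cautiously SMS-conforms.
   Context: RDF graphs: finite sets of triples $(u,p,v)$ ($u\in\mathsf{IRIs}\cup\mathsf{Blanks}$, $p\in\mathsf{IRIs}$, $v\in\mathsf{IRIs}\cup\mathsf{Blanks}\cup\mathsf{Literals}$); $\mathsf{Nodes}(\mathcal{G})$ = elements in subject/object position. A catalogue $\mathcal{C}$ is a partial function with finite domain from shape names to shapes, where every shape name occurring in a declared shape is declared. Shapes are built from shape names $s$, $\top,\bot$, tests $\mathsf{test}(c)$, Boolean connectives $\neg,\land,\lor$, and language-specific constructors (SSL: $\exists p.\varphi$, $\forall p.\varphi$; ShEx: neighbourhood constraints $\langle e\rangle$ with triple expressions; SHACL: counting over path expressions, $\mathsf{closed}$, $\mathsf{eq}$, $\mathsf{disj}$), and for a shape assignment $\alpha\subseteq\mathrm{dom}(\mathcal{C})\times N$, $N=\mathsf{Nodes}(\mathcal{G})\cup\mathsf{Const}(\mathcal{C})$ ($\mathsf{Const}$: constants $c$ in $\mathsf{test}(c)$), the semantics $[\![\varphi]\!]^{\mathcal{G}}_\alpha\subseteq N$ is defined compositionally with $[\![s]\!]=\alpha(s)=\{u\mid(s,u)\in\alpha\}$,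 $\neg$ as complement in $N$, $\land,\lor$ as intersection, union; in particular $[\![\varphi]\!]_\alpha$ depends on $\alpha$ only through the sets $\alpha(s)$ for the names $s$ occurring in $\varphi$. $\alpha$ is correct if $\alpha(s)=[\![\mathcal{C}(s)]\!]_\alpha$ for all $s\in\mathrm{dom}(\mathcal{C})$. $\mathcal{C}$ is recursive if the directed graph on $\mathrm{dom}(\mathcal{C})$ with an edge $(s,t)$ whenever $t$ occurs in $\mathcal{C}(s)$ has a directed cycle. Stratification: partition $\Sigma_0,\dots,\Sigma_n$ of $\mathrm{dom}(\mathcal{C})$ such that declarations for $\Sigma_i$ use only names from $\Sigma_{\le i}$ and apply negation only to $\mathsf{test}(\cdot)$ or to names from $\Sigma_{<i}$; the LFP (GFP) assignment is $\alpha_0\cup\dots\cup\alpha_n$ with $\alpha_i$ the least (largest) assignment over $\Sigma_i$ making $\alpha_0\cup\dots\cup\alpha_i$ correct for $\mathcal{C}$ restricted to $\Sigma_{\le i}$. A selector map is a finite set of selectors $s:\tau$ with $s\in\mathrm{dom}(\mathcal{C})$ and $\tau$ a shape without shape names; $\mathcal{C}_{\mathit{sel}}=\mathcal{C}\cup\{t_{s,\tau}:\tau\land\neg s\mid s:\tau\in\mathit{sel}\}$ with fresh names $t_{s,\tau}$. $\mathcal{G}$ conforms to $(\mathcal{C},\mathit{sel})$ under a correct assignment $\alpha$ for $\mathcal{C}_{\mathit{sel}}$ if $\alpha(t_{s,\tau})=\emptyset$ for all selectors. LFP-/GFP-conformance: conformance under the LFP/GFP assignment of $\mathcal{C}_{\mathit{sel}}$;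 brave (cautious) SMS-conformance: conformance under some (every) correct assignment for $\mathcal{C}_{\mathit{sel}}$. -}

module Defs where

open import Data.Nat using (ℕ; _≤_; _<_)
open import Data.Fin using (Fin)
open import Data.List using (List; map; allFin; _++_; length; lookup)
open import Data.List.Membership.Propositional using (_∈_)
open import Data.List.Relation.Unary.All using (All)
open import Data.List.Relation.Unary.Any using (Any)
open import Data.Product using (Σ; ∃; ∃-syntax; _×_; _,_; proj₁; proj₂)
open import Data.Sum using (_⊎_; inj₁; inj₂)
open import Data.Empty using (⊥; ⊥-elim)
open import Relation.Nullary using (¬_)
open import Relation.Binary.PropositionalEquality using (_≡_)
open import Relation.Binary.Construct.Closure.Transitive using (TransClosure)
open import Function.Bundles using (_⇔_)

data Term : Set where
  iri   : ℕ → Term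
  blank : ℕ → Term
  lit   : ℕ → Term

data IsSubject : Term → Set where
  iri-subj   : ∀ n → IsSubject (iri n)
  blank-subj : ∀ n → IsSubject (blank n)

record Triple : Set where
  constructor ⟨_,_,_⟩
  field
    subj : Term
    pred : ℕ      -- the IRI  iri pred
    obj  : Term

record Graph : Set where
  field
    triples : List Triple
    wf      : All (λ t → IsSubject (Triple.subj t)) triples

InNodes : Graph → Term → Set
InNodes G u = Any (λ t → (Triple.subj t ≡ u) ⊎ (Triple.obj t ≡ u)) (Graph.triples G)

-- Besides the common constructors (names, ⊤, ⊥, test(c), ¬, ∧, ∨), a
-- language provides constructors  o  taking  arity o  sub-shapes
-- (e.g. SSL: ∃p.φ, ∀p.φ; SHACL: ≥n E.φ, closed(Q), eq(E,p), disj(E,p);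
-- ShEx: ⟨e⟩ where the shapes occurring in the triple expression e are the
-- arguments).  Their semantics is a function of the graph and of the
-- denotations of the argument sub-shapes (compositionality).

record Language : Set₁ where
  field
    Op      : Set
    arity   : Op → ℕ
    opSem   : Graph → (o : Op) → (Fin (arity o) → Term → Set) → Term → Set
    opSem-cong : ∀ G o (f g : Fin (arity o) → Term → Set) →
                 (∀ i u → (f i u ⇔ g i u)) → ∀ u → (opSem G o f u ⇔ opSem G o g u)

open Language public

data Shape (L : Language) (X : Set) : Set where
  name  : X → Shape L X
  ⊤ˢ    : Shape L X
  ⊥ˢ    : Shape L X
  test  : Term → Shape L X
  ¬ˢ_   : Shape L X → Shape L X
  _∧ˢ_  : Shape L X → Shape L X → Shape L X
  _∨ˢ_  : Shape L X → Shape L X → Shape L X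
  op    : (o : Op L) → (Fin (arity L o) → Shape L X) → Shape L X

module _ {L : Language} {X : Set} where

  data Occurs (t : X) : Shape L X → Set where
    here : Occurs t (name t)
    neg  : ∀ {φ} → Occurs t φ → Occurs t (¬ˢ φ)
    andˡ : ∀ {φ ψ} → Occurs t φ → Occurs t (φ ∧ˢ ψ)
    andʳ : ∀ {φ ψ} → Occurs t ψ → Occurs t (φ ∧ˢ ψ)
    orˡ  : ∀ {φ ψ} → Occurs t φ → Occurs t (φ ∨ˢ ψ)
    orʳ  : ∀ {φ ψ} → Occurs t ψ → Occurs t (φ ∨ˢ ψ)
    arg  : ∀ {o as} (i : Fin (arity L o)) → Occurs t (as i) → Occurs t (op o as)

  data ConstIn (c : Term) : Shape L X → Set where
    here : ConstIn c (test c)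
    neg  : ∀ {φ} → ConstIn c φ → ConstIn c (¬ˢ φ)
    andˡ : ∀ {φ ψ} → ConstIn c φ → ConstIn c (φ ∧ˢ ψ)
    andʳ : ∀ {φ ψ} → ConstIn c ψ → ConstIn c (φ ∧ˢ ψ)
    orˡ  : ∀ {φ ψ} → ConstIn c φ → ConstIn c (φ ∨ˢ ψ)
    orʳ  : ∀ {φ ψ} → ConstIn c ψ → ConstIn c (φ ∨ˢ ψ)
    arg  : ∀ {o as} (i : Fin (arity L o)) → ConstIn c (as i) → ConstIn c (op o as)

  -- Semantics ⟦φ⟧^G_α ⊆ N, for a graph G, node universe N and assignment α
  -- (α s u  reads  (s,u) ∈ α).
  ⟦_⟧ : Shape L X → Graph → (Term → Set) → (X → Term → Set) → Term → Set
  ⟦ name s   ⟧ G N α u = α s u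
  ⟦ ⊤ˢ       ⟧ G N α u = N u
  ⟦ ⊥ˢ       ⟧ G N α u = ⊥
  ⟦ test c   ⟧ G N α u = N u × (u ≡ c)
  ⟦ ¬ˢ φ     ⟧ G N α u = N u × ¬ (⟦ φ ⟧ G N α u)
  ⟦ φ ∧ˢ ψ   ⟧ G N α u = ⟦ φ ⟧ G N α u × ⟦ ψ ⟧ G N α u
  ⟦ φ ∨ˢ ψ   ⟧ G N α u = ⟦ φ ⟧ G N α u ⊎ ⟦ ψ ⟧ G N α u
  ⟦ op o as  ⟧ G N α u = N u × opSem L G o (λ i → ⟦ as i ⟧ G N α) u

rename : {L : Language} {X Y : Set} → (X → Y) → Shape L X → Shape L Y
rename f (name s)  = name (f s)
rename f ⊤ˢ        = ⊤ˢ
rename f ⊥ˢ        = ⊥ˢ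
rename f (test c)  = test c
rename f (¬ˢ φ)    = ¬ˢ rename f φ
rename f (φ ∧ˢ ψ)  = rename f φ ∧ˢ rename f ψ
rename f (φ ∨ˢ ψ)  = rename f φ ∨ˢ rename f ψ
rename f (op o as) = op o (λ i → rename f (as i))

-- Catalogues: a partial function with finite domain  dom  from shape
-- names to shapes, given by the list  dom  and the declarations  def s
-- (only meaningful for s ∈ dom).

record Catalogue (L : Language) (X : Set) : Set where
  field
    dom : List X
    def : X → Shape L X

open Catalogue public

module _ {L : Language} {X : Set} (C : Catalogue L X) where

  WellFormed : Set
  WellFormed = ∀ s → s ∈ dom C → ∀ t → Occurs t (def C s) → t ∈ dom C

  DepEdge : X → X → Set
  DepEdge s t = (s ∈ dom C) × (t ∈ dom C) × Occurs t (def C s)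

  Recursive : Set
  Recursive = ∃[ s ] TransClosure DepEdge s s

  NonRecursive : Set
  NonRecursive = ¬ Recursive

  NodeUniverse : Graph → Term → Set
  NodeUniverse G u = InNodes G u ⊎ (∃[ s ] (s ∈ dom C) × ConstIn u (def C s))

  ⟦_⟧[_]_ : Shape L X → Graph → (X → Term → Set) → Term → Set
  ⟦ φ ⟧[ G ] α = ⟦ φ ⟧ G (NodeUniverse G) α

  Assignment : Graph → (X → Term → Set) → Set
  Assignment G α = ∀ s u → α s u → (s ∈ dom C) × NodeUniverse G u

  Correct : Graph → (X → Term → Set) → Set
  Correct G α = ∀ s → s ∈ dom C → ∀ u → (α s u ⇔ (⟦ def C s ⟧[ G ] α) u)

  -- Stratification, given as a stratum index  r s  for every name s
  -- (Σ_i = { s ∈ dom C | r s ≡ i }).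

  data NegOK (r : X → ℕ) (i : ℕ) : Shape L X → Set where
    name : ∀ s → NegOK r i (name s)
    top  : NegOK r i ⊤ˢ
    bot  : NegOK r i ⊥ˢ
    test : ∀ c → NegOK r i (test c)
    neg  : ∀ {φ} → (∀ t → Occurs t φ → r t < i) → NegOK r i (¬ˢ φ)
    and  : ∀ {φ ψ} → NegOK r i φ → NegOK r i ψ → NegOK r i (φ ∧ˢ ψ)
    or   : ∀ {φ ψ} → NegOK r i φ → NegOK r i ψ → NegOK r i (φ ∨ˢ ψ)
    op   : ∀ {o as} → (∀ j → NegOK r i (as j)) → NegOK r i (op o as)

  Stratification : (X → ℕ) → Set
  Stratification r =
    ∀ s → s ∈ dom C →
      (∀ t → Occurs t (def C s) → r t ≤ r s) × NegOK r (r s) (def C s)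

  CorrectUpTo : (X → ℕ) → ℕ → Graph → (X → Term → Set) → Set
  CorrectUpTo r i G α =
    ∀ s → s ∈ dom C → r s ≤ i → ∀ u → (α s u ⇔ (⟦ def C s ⟧[ G ] α) u)

  AssignmentOver : (X → ℕ) → ℕ → Graph → (X → Term → Set) → Set
  AssignmentOver r i G β =
    ∀ s u → β s u → (s ∈ dom C) × (r s ≡ i) × NodeUniverse G u

  combine : (X → ℕ) → ℕ → (X → Term → Set) → (X → Term → Set) → X → Term → Set
  combine r i α β s u = ((r s < i) × α s u) ⊎ β s u

  -- α = α_0 ∪ … ∪ α_n is the LFP assignment w.r.t. r: each α_i is the
  -- least assignment over Σ_i making α_0 ∪ … ∪ α_i correct for C|Σ_{≤i}
  IsLFP : (X → ℕ) → Graph → (X → Term → Set) → Set₁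
  IsLFP r G α =
    Assignment G α ×
    (∀ i → CorrectUpTo r i G α ×
           (∀ β → AssignmentOver r i G β →
                  CorrectUpTo r i G (combine r i α β) →
                  ∀ s u → s ∈ dom C → r s ≡ i → α s u → β s u))

  IsGFP : (X → ℕ) → Graph → (X → Term → Set) → Set₁
  IsGFP r G α =
    Assignment G α ×
    (∀ i → CorrectUpTo r i G α ×
           (∀ β → AssignmentOver r i G β →
                  CorrectUpTo r i G (combine r i α β) →
                  ∀ s u → s ∈ dom C → r s ≡ i → β s u → α s u))

-- Selectors.  A selector  s : τ  has  s ∈ dom(C)  and  τ  a shape without
-- shape names (a shape over the empty set of names).

Selector : Language → Set → Set
Selector L X = X × Shape L ⊥

-- C_sel = C ∪ { t_{s,τ} : τ ∧ ¬ s }, where the fresh name for the j-th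
-- selector is  inj₂ j  (names of C become  inj₁ s).
extendSel : {L : Language} {X : Set} → Catalogue L X → (sel : List (Selector L X)) →
            Catalogue L (X ⊎ Fin (length sel))
extendSel {L} {X} C sel = record
  { dom = map inj₁ (dom C) ++ map inj₂ (allFin (length sel))
  ; def = d }
  where
    d : X ⊎ Fin (length sel) → Shape L (X ⊎ Fin (length sel))
    d (inj₁ s) = rename inj₁ (def C s)
    d (inj₂ j) = rename ⊥-elim (proj₂ (lookup sel j)) ∧ˢ (¬ˢ name (inj₁ (proj₁ (lookup sel j))))

module _ {L : Language} {X : Set} (C : Catalogue L X) (sel : List (Selector L X)) (G : Graph) where

  private
    Csel = extendSel C sel
    Y    = X ⊎ Fin (length sel)

  ConformsUnder : (Y → Term → Set) → Set
  ConformsUnder α = ∀ j u → ¬ α (inj₂ j) u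

  LFP-Conforms : Set₁
  LFP-Conforms = ∃[ r ] Stratification Csel r ×
                 (∃[ α ] IsLFP Csel r G α × ConformsUnder α)

  GFP-Conforms : Set₁
  GFP-Conforms = ∃[ r ] Stratification Csel r ×
                 (∃[ α ] IsGFP Csel r G α × ConformsUnder α)

  Brave-Conforms : Set₁
  Brave-Conforms = ∃[ α ] Assignment Csel G α × Correct Csel G α × ConformsUnder α

  Cautious-Conforms : Set₁
  Cautious-Conforms = ∀ α → Assignment Csel G α → Correct Csel G α → ConformsUnder α

-- A non-recursive catalogue has a well-founded dependency relation, so its names can be
-- ranked such that every name occurring in a declaration has strictly smaller rank than the
-- declared name; placing each fresh name t_{s,τ} one above s ranks C_sel as well. Along a
-- ranking a correct assignment is determined rank by rank, so there is exactly one correct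
-- assignment on the declared names. It is both the LFP and the GFP assignment of the
-- stratification by rank, and every LFP or GFP assignment is correct, so all four notions of
-- conformance amount to conformance under this single assignment.
module Submission where

open import Defs
open import Data.Nat using (ℕ; zero; suc; _≤_; _<_; _⊔_; s≤s; _≟_)
open import Data.Nat.Properties using (≤-refl; ≤-trans; <-≤-trans; <⇒≤; <-irrefl; m≤m⊔n; m≤n⊔m; ≤-pred)
open import Data.Fin using (Fin)
open import Data.List using (List; []; map; length; lookup; allFin; filter)
open import Data.List.Properties using (map-cong; filter-notAll)
open import Data.List.Extrema.Nat using (max; xs≤max)
open import Data.List.Relation.Unary.All using (All)
import Data.List.Relation.Unary.All as All
import Data.List.Relation.Unary.Any as Any
open import Data.List.Membership.Propositional using (_∈_)
open import Data.List.Membership.Propositional.Properties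
  using (∈-map⁺; ∈-map⁻; ∈-++⁺ˡ; ∈-++⁺ʳ; ∈-++⁻; ∈-allFin; ∈-lookup; ∈-filter⁺)
import Data.List.Membership.DecPropositional as DecMembership
open import Data.Product using (∃-syntax; _×_; _,_; proj₁; proj₂; curry)
open import Data.Product.Function.NonDependent.Propositional using (_×-⇔_)
open import Data.Sum using (_⊎_; inj₁; inj₂)
open import Data.Sum.Function.Propositional using (_⊎-⇔_)
open import Data.Empty using (⊥; ⊥-elim)
open import Function using (flip; _∘_)
open import Function.Bundles using (_⇔_; mk⇔; Equivalence)
import Function.Properties.Equivalence as ⇔
open import Function.Related.TypeIsomorphisms using (¬-cong-⇔)
open import Level using (0ℓ)
open import Relation.Nullary using (¬_; yes; no; ¬?; contradiction)
open import Relation.Binary using (Rel; DecidableEquality)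
open import Relation.Binary.PropositionalEquality using (_≡_; refl; sym; cong; cong₂; subst)
open import Relation.Binary.Construct.Closure.Transitive using (TransClosure; [_]; _∷_)
open import Induction.WellFounded using (WellFounded; WfRec; Acc; acc; module All; module FixPoint)

open Equivalence using (to; from)

Agree : {X : Set} → (X → Set) → (X → Term → Set) → (X → Term → Set) → Set
Agree P α β = ∀ {t} → P t → ∀ u → α t u ⇔ β t u

module _ {L : Language} {X : Set} where

  ⟦⟧-cong : ∀ G N (φ : Shape L X) {α β} →
            Agree (λ t → Occurs t φ) α β → ∀ u → ⟦ φ ⟧ G N α u ⇔ ⟦ φ ⟧ G N β u
  ⟦⟧-cong G N (name s)  h = h here
  ⟦⟧-cong G N ⊤ˢ        h u = ⇔.refl
  ⟦⟧-cong G N ⊥ˢ        h u = ⇔.refl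
  ⟦⟧-cong G N (test c)  h u = ⇔.refl
  ⟦⟧-cong G N (¬ˢ φ)    h u = ⇔.refl ×-⇔ ¬-cong-⇔ (⟦⟧-cong G N φ (h ∘ neg) u)
  ⟦⟧-cong G N (φ ∧ˢ ψ)  h u = ⟦⟧-cong G N φ (h ∘ andˡ) u ×-⇔ ⟦⟧-cong G N ψ (h ∘ andʳ) u
  ⟦⟧-cong G N (φ ∨ˢ ψ)  h u = ⟦⟧-cong G N φ (h ∘ orˡ) u ⊎-⇔ ⟦⟧-cong G N ψ (h ∘ orʳ) u
  ⟦⟧-cong G N (op o as) h u =
    ⇔.refl ×-⇔ opSem-cong L G o _ _ (λ i → ⟦⟧-cong G N (as i) (h ∘ arg i)) u

  ⟦⟧-⊆ : ∀ G N (φ : Shape L X) {α} → (∀ t u → α t u → N u) → ∀ u → ⟦ φ ⟧ G N α u → N u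
  ⟦⟧-⊆ G N (name s)  α⊆N u x        = α⊆N s u x
  ⟦⟧-⊆ G N ⊤ˢ        α⊆N u x        = x
  ⟦⟧-⊆ G N (test c)  α⊆N u (x , _)  = x
  ⟦⟧-⊆ G N (¬ˢ φ)    α⊆N u (x , _)  = x
  ⟦⟧-⊆ G N (φ ∧ˢ ψ)  α⊆N u (x , _)  = ⟦⟧-⊆ G N φ α⊆N u x
  ⟦⟧-⊆ G N (φ ∨ˢ ψ)  α⊆N u (inj₁ x) = ⟦⟧-⊆ G N φ α⊆N u x
  ⟦⟧-⊆ G N (φ ∨ˢ ψ)  α⊆N u (inj₂ x) = ⟦⟧-⊆ G N ψ α⊆N u x
  ⟦⟧-⊆ G N (op o as) α⊆N u (x , _)  = x

  maxOccurs : (φ : Shape L X) → (∀ {t} → Occurs t φ → ℕ) → ℕ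
  maxOccurs (name s)  f = f here
  maxOccurs ⊤ˢ        f = 0
  maxOccurs ⊥ˢ        f = 0
  maxOccurs (test c)  f = 0
  maxOccurs (¬ˢ φ)    f = maxOccurs φ (f ∘ neg)
  maxOccurs (φ ∧ˢ ψ)  f = maxOccurs φ (f ∘ andˡ) ⊔ maxOccurs ψ (f ∘ andʳ)
  maxOccurs (φ ∨ˢ ψ)  f = maxOccurs φ (f ∘ orˡ) ⊔ maxOccurs ψ (f ∘ orʳ)
  maxOccurs (op o as) f = max 0 (map (λ i → maxOccurs (as i) (f ∘ arg i)) (allFin (arity L o)))

  ≤-maxOccurs : ∀ {φ t} (f : ∀ {t} → Occurs t φ → ℕ) (o : Occurs t φ) → f o ≤ maxOccurs φ f
  ≤-maxOccurs f here     = ≤-refl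
  ≤-maxOccurs f (neg o)  = ≤-maxOccurs (f ∘ neg) o
  ≤-maxOccurs f (andˡ o) = ≤-trans (≤-maxOccurs (f ∘ andˡ) o) (m≤m⊔n _ _)
  ≤-maxOccurs f (andʳ o) = ≤-trans (≤-maxOccurs (f ∘ andʳ) o) (m≤n⊔m _ _)
  ≤-maxOccurs f (orˡ o)  = ≤-trans (≤-maxOccurs (f ∘ orˡ) o) (m≤m⊔n _ _)
  ≤-maxOccurs f (orʳ o)  = ≤-trans (≤-maxOccurs (f ∘ orʳ) o) (m≤n⊔m _ _)
  ≤-maxOccurs {op o as} f (arg i oc) =
    ≤-trans (≤-maxOccurs (f ∘ arg i) oc)
            (All.lookup (xs≤max 0 (map g (allFin _))) (∈-map⁺ g (∈-allFin i)))
    where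
    g : Fin (arity L o) → ℕ
    g i = maxOccurs (as i) (f ∘ arg i)

  maxOccurs-cong : ∀ φ {f g : ∀ {t} → Occurs t φ → ℕ} →
                   (∀ {t} (o : Occurs t φ) → f o ≡ g o) → maxOccurs φ f ≡ maxOccurs φ g
  maxOccurs-cong (name s)  f≗g = f≗g here
  maxOccurs-cong ⊤ˢ        f≗g = refl
  maxOccurs-cong ⊥ˢ        f≗g = refl
  maxOccurs-cong (test c)  f≗g = refl
  maxOccurs-cong (¬ˢ φ)    f≗g = maxOccurs-cong φ (f≗g ∘ neg)
  maxOccurs-cong (φ ∧ˢ ψ)  f≗g =
    cong₂ _⊔_ (maxOccurs-cong φ (f≗g ∘ andˡ)) (maxOccurs-cong ψ (f≗g ∘ andʳ))
  maxOccurs-cong (φ ∨ˢ ψ)  f≗g =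
    cong₂ _⊔_ (maxOccurs-cong φ (f≗g ∘ orˡ)) (maxOccurs-cong ψ (f≗g ∘ orʳ))
  maxOccurs-cong (op o as) f≗g =
    cong (max 0) (map-cong (λ i → maxOccurs-cong (as i) (f≗g ∘ arg i)) (allFin (arity L o)))

Occurs-rename : ∀ {L X Y} (f : X → Y) (φ : Shape L X) {t} →
                Occurs t (rename f φ) → ∃[ t′ ] f t′ ≡ t × Occurs t′ φ
Occurs-rename f (name s)  here = s , refl , here
Occurs-rename f (¬ˢ φ)    (neg o) with t′ , eq , o′ ← Occurs-rename f φ o = t′ , eq , neg o′
Occurs-rename f (φ ∧ˢ ψ)  (andˡ o) with t′ , eq , o′ ← Occurs-rename f φ o = t′ , eq , andˡ o′
Occurs-rename f (φ ∧ˢ ψ)  (andʳ o) with t′ , eq , o′ ← Occurs-rename f ψ o = t′ , eq , andʳ o′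
Occurs-rename f (φ ∨ˢ ψ)  (orˡ o) with t′ , eq , o′ ← Occurs-rename f φ o = t′ , eq , orˡ o′
Occurs-rename f (φ ∨ˢ ψ)  (orʳ o) with t′ , eq , o′ ← Occurs-rename f ψ o = t′ , eq , orʳ o′
Occurs-rename f (op o as) (arg i oc) with t′ , eq , o′ ← Occurs-rename f (as i) oc = t′ , eq , arg i o′

module _ {a ℓ} {A : Set a} (_≟_ : DecidableEquality A) {_⟶_ : Rel A ℓ} where

  -- Acyclicity forbids returning to a node, so every step shrinks the finite list of nodes
  -- still reachable.
  acyclic⇒wellFounded : (D : List A) → (∀ {x y} → x ⟶ y → y ∈ D) →
                        (∀ x → ¬ TransClosure _⟶_ x x) → WellFounded (flip _⟶_)
  acyclic⇒wellFounded D ⟶∈D acyclic x = accessible (length D) D ≤-refl x reachable∈D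
    where
    reachable∈D : ∀ {x y} → TransClosure _⟶_ x y → y ∈ D
    reachable∈D [ x⟶y ] = ⟶∈D x⟶y
    reachable∈D (_ ∷ p) = reachable∈D p

    _∖_ : List A → A → List A
    W ∖ y = filter (¬? ∘ (_≟ y)) W

    ∖-shorter : ∀ {W y} → y ∈ W → length (W ∖ y) < length W
    ∖-shorter {W} y∈W = filter-notAll (¬? ∘ (_≟ _)) W (Any.map (λ { refl y≢y → y≢y refl }) y∈W)

    ∈-∖ : ∀ {W y z} → z ∈ W → ¬ z ≡ y → z ∈ W ∖ y
    ∈-∖ = ∈-filter⁺ (¬? ∘ (_≟ _))

    accessible : ∀ n (W : List A) → length W ≤ n → ∀ x →
                 (∀ {y} → TransClosure _⟶_ x y → y ∈ W) → Acc (flip _⟶_) x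
    accessible zero    []  _         x reach = acc λ x⟶y → contradiction (reach [ x⟶y ]) λ ()
    accessible (suc n) W |W|≤1+n x reach = acc λ {y} x⟶y →
      accessible n (W ∖ y) (≤-pred (<-≤-trans (∖-shorter (reach [ x⟶y ])) |W|≤1+n)) y
        (λ y⟶⁺z → ∈-∖ (reach (x⟶y ∷ y⟶⁺z)) λ { refl → acyclic y y⟶⁺z })

Ranking : ∀ {L X} → Catalogue L X → (X → ℕ) → Set
Ranking C rank = ∀ {s t} → s ∈ dom C → Occurs t (def C s) → t ∈ dom C × rank t < rank s

module NonRecursiveRanking {L X} (_≟_ : DecidableEquality X) (C : Catalogue L X)
                           (wfC : WellFormed C) (nonRec : NonRecursive C) where

  open DecMembership _≟_ using (_∈?_)

  private
    _⟵_ : Rel X 0ℓ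
    t ⟵ s = DepEdge C s t

    ⟵-wellFounded : WellFounded _⟵_
    ⟵-wellFounded = acyclic⇒wellFounded _≟_ (dom C) (proj₁ ∘ proj₂) (curry nonRec)

    rankStep : ∀ s → WfRec _⟵_ (λ _ → ℕ) s → ℕ
    rankStep s rec with s ∈? dom C
    ... | yes s∈ = suc (maxOccurs (def C s) λ o → rec (s∈ , wfC s s∈ _ o , o))
    ... | no _   = 0

    rankStep-ext : ∀ s {rec rec′ : WfRec _⟵_ (λ _ → ℕ) s} →
                   (∀ {t} (t⟵s : t ⟵ s) → rec t⟵s ≡ rec′ t⟵s) → rankStep s rec ≡ rankStep s rec′
    rankStep-ext s rec≗rec′ with s ∈? dom C
    ... | yes s∈ = cong suc (maxOccurs-cong (def C s) λ o → rec≗rec′ _)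
    ... | no _   = refl

  rank : X → ℕ
  rank = All.wfRec ⟵-wellFounded 0ℓ (λ _ → ℕ) rankStep

  private
    rank-unfold : ∀ {s} → rank s ≡ rankStep s (λ {t} _ → rank t)
    rank-unfold = FixPoint.unfold-wfRec ⟵-wellFounded (λ _ → ℕ) rankStep rankStep-ext

    rank<rankStep : ∀ {s t} → s ∈ dom C → Occurs t (def C s) → rank t < rankStep s (λ {t} _ → rank t)
    rank<rankStep {s} s∈ o with s ∈? dom C
    ... | yes _ = s≤s (≤-maxOccurs (λ {t} _ → rank t) o)
    ... | no s∉ = contradiction s∈ s∉

  rank-ranking : Ranking C rank
  rank-ranking {s} {t} s∈ o = wfC s s∈ t o , subst (rank t <_) (sym rank-unfold) (rank<rankStep s∈ o)

module _ {L X} (C : Catalogue L X) {r : X → ℕ} {G : Graph} {α : X → Term → Set} where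

  correctUpTo⇒correct : (∀ i → CorrectUpTo C r i G α) → Correct C G α
  correctUpTo⇒correct correct≤ s s∈ = correct≤ (r s) s s∈ ≤-refl

  isLFP⇒correct : IsLFP C r G α → Correct C G α
  isLFP⇒correct (_ , lfp) = correctUpTo⇒correct (proj₁ ∘ lfp)

  isGFP⇒correct : IsGFP C r G α → Correct C G α
  isGFP⇒correct (_ , gfp) = correctUpTo⇒correct (proj₁ ∘ gfp)

module _ {L X} (C : Catalogue L X) {r : X → ℕ} where

  below⇒NegOK : ∀ {i} φ → (∀ {t} → Occurs t φ → r t < i) → NegOK C r i φ
  below⇒NegOK (name s)  _ = name s
  below⇒NegOK ⊤ˢ        _ = top
  below⇒NegOK ⊥ˢ        _ = bot
  below⇒NegOK (test c)  _ = test c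
  below⇒NegOK (¬ˢ φ)    h = neg (λ t → h ∘ neg)
  below⇒NegOK (φ ∧ˢ ψ)  h = and (below⇒NegOK φ (h ∘ andˡ)) (below⇒NegOK ψ (h ∘ andʳ))
  below⇒NegOK (φ ∨ˢ ψ)  h = or (below⇒NegOK φ (h ∘ orˡ)) (below⇒NegOK ψ (h ∘ orʳ))
  below⇒NegOK (op o as) h = op (λ j → below⇒NegOK (as j) (h ∘ arg j))

module Ranked {L X} (C : Catalogue L X) {rank : X → ℕ} (ranked : Ranking C rank) (G : Graph) where

  N : Term → Set
  N = NodeUniverse C G

  Below : ℕ → X → Set
  Below n s = s ∈ dom C × rank s < n

  ⟦def⟧-cong : ∀ {s α β} → s ∈ dom C → Agree (Below (rank s)) α β →
               ∀ u → ⟦ def C s ⟧ G N α u ⇔ ⟦ def C s ⟧ G N β u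
  ⟦def⟧-cong {s} s∈ agree = ⟦⟧-cong G N (def C s) (agree ∘ ranked s∈)

  correctUpTo-agree : ∀ {i α β} → CorrectUpTo C rank i G α → CorrectUpTo C rank i G β →
                      Agree (Below (suc i)) α β
  correctUpTo-agree {i} {α} {β} correctα correctβ = agreeBelow (suc i) ≤-refl
    where
    agreeBelow : ∀ n → n ≤ suc i → Agree (Below n) α β
    agreeBelow (suc n) 1+n≤1+i {s} (s∈ , s≤s rs≤n) u =
      ⇔.trans (correctα s s∈ rs≤i u)
        (⇔.trans (⟦def⟧-cong s∈ below u) (⇔.sym (correctβ s s∈ rs≤i u)))
      where
      rs≤i : rank s ≤ i
      rs≤i = ≤-trans rs≤n (≤-pred 1+n≤1+i)

      below : Agree (Below (rank s)) α β
      below (t∈ , rt<rs) = agreeBelow n (<⇒≤ 1+n≤1+i) (t∈ , <-≤-trans rt<rs rs≤n)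

  correct-agree : ∀ {α β} → Correct C G α → Correct C G β → Agree (_∈ dom C) α β
  correct-agree correctα correctβ {s} s∈ =
    correctUpTo-agree {rank s} (λ s s∈ _ → correctα s s∈) (λ s s∈ _ → correctβ s s∈) (s∈ , ≤-refl)

  iterate : ℕ → X → Term → Set
  iterate zero    s u = ⊥
  iterate (suc k) s u = s ∈ dom C × ⟦ def C s ⟧ G N (iterate k) u

  iterate-stable : ∀ {k m} → k ≤ m → Agree (Below k) (iterate k) (iterate m)
  iterate-stable {suc k} {suc m} (s≤s k≤m) (s∈ , s≤s rs≤k) u =
    ⇔.refl ×-⇔ ⟦def⟧-cong s∈ (λ (t∈ , rt<rs) → iterate-stable k≤m (t∈ , <-≤-trans rt<rs rs≤k)) u

  iterate-⊆ : ∀ k s u → iterate k s u → N u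
  iterate-⊆ (suc k) s u (_ , x) = ⟦⟧-⊆ G N (def C s) (iterate-⊆ k) u x

  canonical : X → Term → Set
  canonical s = iterate (suc (rank s)) s

  canonical-assignment : Assignment C G canonical
  canonical-assignment s u x = proj₁ x , iterate-⊆ (suc (rank s)) s u x

  canonical-correct : Correct C G canonical
  canonical-correct s s∈ u = mk⇔ (to iterate≐canonical ∘ proj₂) ((s∈ ,_) ∘ from iterate≐canonical)
    where
    iterate≐canonical : ⟦ def C s ⟧ G N (iterate (rank s)) u ⇔ ⟦ def C s ⟧ G N canonical u
    iterate≐canonical = ⟦def⟧-cong s∈ (λ (t∈ , rt<rs) → ⇔.sym ∘ iterate-stable rt<rs (t∈ , ≤-refl)) u

  ranking-stratification : Stratification C rank
  ranking-stratification s s∈ =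
    (λ t → <⇒≤ ∘ proj₂ ∘ ranked s∈) , below⇒NegOK C (def C s) (proj₂ ∘ ranked s∈)

  private
    combine-agree : ∀ {i β} → CorrectUpTo C rank i G (combine C rank i canonical β) →
                    Agree (Below (suc i)) (combine C rank i canonical β) canonical
    combine-agree correctβ = correctUpTo-agree correctβ (λ s s∈ _ → canonical-correct s s∈)

  canonical-isLFP : IsLFP C rank G canonical
  canonical-isLFP = canonical-assignment , λ i →
    (λ s s∈ _ → canonical-correct s s∈) ,
    λ { β _ correctβ s u s∈ refl →
          combine⇒β {β = β} ∘ from (combine-agree {β = β} correctβ (s∈ , ≤-refl) u) }
    where
    combine⇒β : ∀ {β s u} → combine C rank (rank s) canonical β s u → β s u
    combine⇒β (inj₁ (rs<rs , _)) = contradiction rs<rs (<-irrefl refl)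
    combine⇒β (inj₂ x)           = x

  canonical-isGFP : IsGFP C rank G canonical
  canonical-isGFP = canonical-assignment , λ i →
    (λ s s∈ _ → canonical-correct s s∈) ,
    λ { β _ correctβ s u s∈ refl x → to (combine-agree {β = β} correctβ (s∈ , ≤-refl) u) (inj₂ x) }

module _ {L X} (C : Catalogue L X) (sel : List (Selector L X)) where

  private
    Csel = extendSel C sel

    inj₁∈ : ∀ {s} → s ∈ dom C → inj₁ s ∈ dom Csel
    inj₁∈ = ∈-++⁺ˡ ∘ ∈-map⁺ inj₁

    inj₁∈⁻ : ∀ {s} → inj₁ s ∈ dom Csel → s ∈ dom C
    inj₁∈⁻ s∈ with ∈-++⁻ (map inj₁ (dom C)) s∈
    ... | inj₁ s∈₁ with _ , s∈ , refl ← ∈-map⁻ inj₁ s∈₁ = s∈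
    ... | inj₂ s∈₂ with _ , _ , () ← ∈-map⁻ inj₂ s∈₂

  selector∈ : ∀ j → inj₂ j ∈ dom Csel
  selector∈ j = ∈-++⁺ʳ (map inj₁ (dom C)) (∈-map⁺ inj₂ (∈-allFin j))

  selectorRank : (X → ℕ) → X ⊎ Fin (length sel) → ℕ
  selectorRank rank (inj₁ s) = rank s
  selectorRank rank (inj₂ j) = suc (rank (proj₁ (lookup sel j)))

  extendSel-ranking : ∀ {rank} → Ranking C rank → All (λ st → proj₁ st ∈ dom C) sel →
                      Ranking Csel (selectorRank rank)
  extendSel-ranking ranked _ {inj₁ s} s∈ o with _ , refl , o′ ← Occurs-rename inj₁ (def C s) o
    with t∈ , rt<rs ← ranked (inj₁∈⁻ s∈) o′ = inj₁∈ t∈ , rt<rs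
  extendSel-ranking ranked _ {inj₂ j} _ (andˡ o) with () , _ ← Occurs-rename ⊥-elim (proj₂ (lookup sel j)) o
  extendSel-ranking ranked sel⊆dom {inj₂ j} _ (andʳ (neg here)) =
    inj₁∈ (All.lookup sel⊆dom (∈-lookup j)) , ≤-refl

module Conformance {L X} (C : Catalogue L X) (sel : List (Selector L X)) (G : Graph)
                   {rank} (ranked : Ranking (extendSel C sel) rank) where

  open Ranked (extendSel C sel) ranked G

  conformance-invariant : ∀ {α β} → Correct (extendSel C sel) G α → Correct (extendSel C sel) G β →
                          ConformsUnder C sel G α → ConformsUnder C sel G β
  conformance-invariant correctα correctβ conforms j u =
    conforms j u ∘ from (correct-agree correctα correctβ (selector∈ C sel j) u)

  Canonical-Conforms : Set
  Canonical-Conforms = ConformsUnder C sel G canonical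

  lfp⇔canonical : LFP-Conforms C sel G ⇔ Canonical-Conforms
  lfp⇔canonical = mk⇔
    (λ (_ , _ , _ , lfp , conforms) → conformance-invariant (isLFP⇒correct _ lfp) canonical-correct conforms)
    (λ conforms → rank , ranking-stratification , canonical , canonical-isLFP , conforms)

  gfp⇔canonical : GFP-Conforms C sel G ⇔ Canonical-Conforms
  gfp⇔canonical = mk⇔
    (λ (_ , _ , _ , gfp , conforms) → conformance-invariant (isGFP⇒correct _ gfp) canonical-correct conforms)
    (λ conforms → rank , ranking-stratification , canonical , canonical-isGFP , conforms)

  brave⇔canonical : Brave-Conforms C sel G ⇔ Canonical-Conforms
  brave⇔canonical = mk⇔
    (λ (_ , _ , correct , conforms) → conformance-invariant correct canonical-correct conforms)
    (λ conforms → canonical , canonical-assignment , canonical-correct , conforms)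

  cautious⇔canonical : Cautious-Conforms C sel G ⇔ Canonical-Conforms
  cautious⇔canonical = mk⇔
    (λ conforms → conforms canonical canonical-assignment canonical-correct)
    (λ conforms _ _ correct → conformance-invariant canonical-correct correct conforms)

proposition6 : (L : Language) (C : Catalogue L ℕ) → WellFormed C → NonRecursive C →
               (G : Graph) (sel : List (Selector L ℕ)) →
               All (λ st → proj₁ st ∈ dom C) sel →
               (LFP-Conforms C sel G ⇔ GFP-Conforms C sel G) ×
               (GFP-Conforms C sel G ⇔ Brave-Conforms C sel G) ×
               (Brave-Conforms C sel G ⇔ Cautious-Conforms C sel G)
proposition6 L C wfC nonRec G sel sel⊆dom =
  ⇔.trans lfp⇔canonical (⇔.sym gfp⇔canonical) ,
  ⇔.trans gfp⇔canonical (⇔.sym brave⇔canonical) ,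
  ⇔.trans brave⇔canonical (⇔.sym cautious⇔canonical)
  where
  open NonRecursiveRanking _≟_ C wfC nonRec using (rank-ranking)
  open Conformance C sel G (extendSel-ranking C sel rank-ranking sel⊆dom)
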